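{- Let $L\ge 1$ and let $\mathcal{T}$ be an $L$-decreasing tree of depth $D$ whose root $r$ has a single child $q$. Consider the algorithm OnAlgTreesDeadlines for MLAP-D on $\mathcal{T}$, and let $(X,t)$ be any service it issues. Then $\ell(X)\le (2+1/L)^{D-1}\,\ell_q$.
   Context: MLAP-D on a rooted tree $\mathcal{T}$ with root $r$: each node $v\neq r$ has positive weight $\ell_v$, $\ell_r=0$, $\ell(Z)=\sum_{v\in Z}\ell_v$. Requests $\rho$ arrive online at nodes $v_\rho$ at times $a_\rho$ with deadlines $d_\rho$ (assumed all distinct); a service $(X,t)$, $X$ a subtree containing $r$, costs $\ell(X)$ and serves all pending requests at nodes of $X$. A tree is $L$-decreasing if $\ell_u\ge L\ell_v$ for every node $u\neq r$ and child $v$ of $u$. The depth of a node is its number of edges from $r$; for a node set $Z$, $Z^i$ is the set of its nodes of depth $i$, $Z^{<i}=\bigcup_{j<i}Z^j$, and $Z_v$ is the set of descendants of $v$ (including $v$) in $Z$. At time $t$, $d^t(v)$ is the earliest deadline among requests pending for the algorithm at nodes in the subtree of $\mathcal{T}$ rooted at $v$ ($+\infty$ if none). For a node set $A$ and $\beta\ge 0$, $U(A,\beta)$ denotes a smallest subset $S\subseteq A$ such that $d^t(u)\le d^t(w)$ for all $u\in S$, $w\in A\setminus S$, and either $\ell(S)\ge\beta$ or $S=A$. Algorithm OnAlgTreesDeadlines: at every time $t$ with $t=d^t(r)$ (some pending request reaches its deadline) it serves the set $X$ built as follows: initialize $X=\{r,q\}$; for $i=2,\dots,D$: let $Z^i$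 be the set of all children of nodes in $X^{i-1}$; for each $v\in X^{<i}$, add to $X$ the set $U(Z^i_v,\ell_v)$.
   Formalization: The node weights $\ell_v$, the parameter $L$, and the request deadlines and service times are rational. -}

module Defs where

open import Data.Nat using (ℕ; zero; suc; _≡ᵇ_)

open import Data.Fin using (Fin; zero; suc; _≟_)
open import Data.Fin.Subset using (Subset; _∈_; _∉_; _⊆_; ∣_∣; inside; outside)
open import Data.Fin.Subset.Properties using (_∈?_)
open import Data.Bool using (Bool; true; false; if_then_else_; _∧_)
open import Data.Vec using (Vec; []; _∷_; tabulate; lookup)
open import Data.List using (List; []; _∷_; upTo)
open import Data.Bool.ListAction using (any)
open import Data.Maybe using (Maybe; just; nothing)
open import Data.Product using (_×_; _,_; Σ; ∃; proj₁; proj₂)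
open import Data.Sum using (_⊎_)
open import Data.Unit using (⊤)
open import Data.Empty using (⊥)
open import Data.Rational using (ℚ; 0ℚ; 1ℚ; _+_; _*_; _≤_; _<_; _⊓_)
open import Relation.Nullary using (¬_)
open import Relation.Nullary.Decidable using (⌊_⌋)
open import Relation.Binary.PropositionalEquality using (_≡_; _≢_)

Node : ℕ → Set
Node n = Fin (suc n)

root : ∀ {n} → Node n
root = zero

-- A rooted tree: a parent map and a depth function with
-- depth r = 0 and depth v = 1 + depth (parent v) for v ≠ r.
-- (Following parents strictly decreases depth and only r has depth 0,
--  so every node reaches r: this is exactly a tree rooted at r.)
record RootedTree (n : ℕ) : Set where
  field
    parent       : Node n → Node n
    depth        : Node n → ℕ
    depth-root   : depth root ≡ 0
    depth-parent : ∀ v → v ≢ root → depth v ≡ suc (depth (parent v))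
open RootedTree public

ancestor : ∀ {n} → RootedTree n → ℕ → Node n → Node n
ancestor T zero    w = w
ancestor T (suc k) w = ancestor T k (parent T w)

isDesc : ∀ {n} → RootedTree n → Node n → Node n → Bool
isDesc T w v = any (λ k → ⌊ ancestor T k w ≟ v ⌋) (upTo (suc (depth T w)))

HasDepth : ∀ {n} → RootedTree n → ℕ → Set
HasDepth T D = (∀ v → depth T v Data.Nat.≤ D) × ∃ λ v → depth T v ≡ D

SingleRootChild : ∀ {n} → RootedTree n → Node n → Set
SingleRootChild T q =
  q ≢ root × parent T q ≡ root × (∀ v → v ≢ root → parent T v ≡ root → v ≡ q)

ValidWeights : ∀ {n} → (Node n → ℚ) → Set
ValidWeights ℓ = ℓ root ≡ 0ℚ × (∀ v → v ≢ root → 0ℚ < ℓ v)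

LDecreasing : ∀ {n} → RootedTree n → (Node n → ℚ) → ℚ → Set
LDecreasing T ℓ L = ∀ v → v ≢ root → parent T v ≢ root → L * ℓ v ≤ ℓ (parent T v)

weightOf : ∀ {m} → (Fin m → ℚ) → Subset m → ℚ
weightOf ℓ []            = 0ℚ
weightOf ℓ (true  ∷ s)  = ℓ zero + weightOf (λ i → ℓ (suc i)) s
weightOf ℓ (false ∷ s)  = weightOf (λ i → ℓ (suc i)) s

-- deadlines extended with +∞ (nothing = +∞)
DL : Set
DL = Maybe ℚ

_≤D_ : DL → DL → Set
just a  ≤D just b  = a ≤ b
just a  ≤D nothing = ⊤
nothing ≤D just b  = ⊥
nothing ≤D nothing = ⊤

minD : DL → DL → DL
minD (just a) (just b) = just (a ⊓ b)
minD (just a) nothing  = just a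
minD nothing  y        = y

-- a pending request: (node v_ρ , deadline d_ρ)
Request : ℕ → Set
Request n = Node n × ℚ

dt : ∀ {n} → RootedTree n → List (Request n) → Node n → DL
dt T []             v = nothing
dt T ((w , d) ∷ P)  v =
  if isDesc T w v then minD (just d) (dt T P v) else dt T P v

-- the condition defining U(A,β) (without minimality):
-- S ⊆ A, S is a prefix of A in d-order, and ℓ(S) ≥ β or S = A
UCond : ∀ {n} → (Node n → DL) → (Node n → ℚ) → Subset (suc n) → ℚ → Subset (suc n) → Set
UCond d ℓ A β S =
  S ⊆ A ×
  (∀ u w → u ∈ S → w ∈ A → w ∉ S → d u ≤D d w) ×
  (β ≤ weightOf ℓ S ⊎ S ≡ A)

IsU : ∀ {n} → (Node n → DL) → (Node n → ℚ) → Subset (suc n) → ℚ → Subset (suc n) → Set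
IsU d ℓ A β S = UCond d ℓ A β S × (∀ S′ → UCond d ℓ A β S′ → ∣ S ∣ Data.Nat.≤ ∣ S′ ∣)

Zset : ∀ {n} → RootedTree n → Subset (suc n) → ℕ → Node n → Subset (suc n)
Zset T X i v = tabulate λ w →
  (depth T w ≡ᵇ i) ∧ (⌊ parent T w ∈? X ⌋ ∧ isDesc T w v)

-- one iteration i of the loop: X′ = X ∪ ⋃_{v ∈ X^{<i}} U(Z^i_v, ℓ_v),
-- for some admissible choice of each U(Z^i_v, ℓ_v)
Step : ∀ {n} → RootedTree n → (Node n → ℚ) → (Node n → DL) →
       ℕ → Subset (suc n) → Subset (suc n) → Set
Step T ℓ d i X X′ = Σ (Node _ → Subset (suc _)) λ S →
  (∀ v → v ∈ X → depth T v Data.Nat.< i → IsU d ℓ (Zset T X i v) (ℓ v) (S v)) ×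
  (∀ w → w ∈ X′ → w ∈ X ⊎ ∃ λ v → v ∈ X × depth T v Data.Nat.< i × w ∈ S v) ×
  (∀ w → w ∈ X → w ∈ X′) ×
  (∀ w v → v ∈ X → depth T v Data.Nat.< i → w ∈ S v → w ∈ X′)

-- Reach T ℓ d q k X : X is the set obtained after running the loop for
-- i = 2, …, k-1 starting from X = {r,q}
data Reach {n} (T : RootedTree n) (ℓ : Node n → ℚ) (d : Node n → DL) (q : Node n)
           : ℕ → Subset (suc n) → Set where
  init : ∀ X → (∀ w → w ∈ X → w ≡ root ⊎ w ≡ q) → root ∈ X → q ∈ X → Reach T ℓ d q 2 X
  step : ∀ {i X X′} → Reach T ℓ d q i X → Step T ℓ d i X X′ → Reach T ℓ d q (suc i) X′

-- X is a set the algorithm may serve (loop i = 2..D completed)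
ServedSet : ∀ {n} → RootedTree n → (Node n → ℚ) → (Node n → DL) → Node n → ℕ → Subset (suc n) → Set
ServedSet T ℓ d q D X = Reach T ℓ d q (suc D) X

_^Q_ : ℚ → ℕ → ℚ
x ^Q zero  = 1ℚ
x ^Q suc k = x * (x ^Q k)

{-# OPTIONS --safe #-}

-- Fix a round i of the loop and v ∈ X of depth < i, and let S = U(Z^i_v, ℓ_v).  Removing
-- from S an element u of latest deadline leaves a smaller d-prefix of Z^i_v, so by minimality
-- ℓ(S − u) < ℓ_v (for v = r this forces S = ∅); and u is a proper descendant of v, so
-- ℓ_u ≤ ℓ_v / L by L-decreasingness (using L ≥ 1 across several generations).  Hence
-- ℓ(S) ≤ (1 + 1/L) ℓ_v, and since every new node lies in one of these sets, a round turns X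
-- into a set of weight at most ℓ(X) + (1 + 1/L) ℓ(X).  The D − 1 rounds start from {r, q},
-- of weight ℓ_q.
module Submission where

open import Defs
open import Data.Nat using (ℕ; zero; suc; _∸_)
open import Data.Rational using (ℚ; 1ℚ; _+_; _*_; _≤_; 1/_; NonZero)
open import Data.Fin.Subset using (Subset)
open import Data.List using (List; map)
open import Data.List.Relation.Unary.Unique.Propositional using (Unique)
open import Data.Product using (proj₂)
open import Data.Maybe using (just)
open import Relation.Binary.PropositionalEquality using (_≡_)

import Data.Nat as ℕ
import Data.Nat.Properties as ℕₚ
open import Data.Rational using (0ℚ; _<_; Positive; positive; nonNegative)
import Data.Rational.Properties as ℚ
open import Data.Rational.Solver using (module +-*-Solver)
open +-*-Solver using (solve; _:=_; _:+_; _:*_; con)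
open import Data.Bool using (Bool; _∧_) renaming (T to True)
open import Data.Bool.Properties using (T-∧; T-≡)
open import Data.Fin using (Fin; zero; suc; _≟_)
open import Data.Fin.Subset using (_∈_; _∉_; _⊆_; _∪_; _-_; ⁅_⁆; inside; outside; Empty)
  renaming (⊥ to ∅)
open import Data.Fin.Subset.Properties
  using (_∈?_; drop-∷-⊆; ⊥⊆; x∈p∪q⁺; x∈⁅x⁆; x∈p∧x≢y⇒x∈p-y; p─q⊆p; x∈p⇒∣p-x∣<∣p∣; Empty-unique)
open import Data.Vec using (_∷_; []; here; there)
open import Data.Vec.Properties using (lookup∘tabulate; []=⇒lookup)
open import Data.List.Membership.Propositional using (find)
open import Data.List.Membership.Propositional.Properties using (∈-upTo⁻)
open import Data.List.Relation.Unary.Any.Properties using (any⁻)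
open import Data.Maybe using (nothing)
open import Data.Product using (_×_; _,_; ∃; proj₁)
open import Data.Sum using (_⊎_; inj₁; inj₂)
open import Data.Unit using (tt)
open import Data.Empty using (⊥-elim)
open import Function using (_∘_)
open import Function.Bundles using (Equivalence)
open import Level using (0ℓ)
open import Relation.Nullary using (yes; no; contradiction)
open import Relation.Nullary.Decidable using (⌊_⌋; toWitness)
open import Relation.Binary.Bundles using (TotalPreorder)
open import Relation.Binary.PropositionalEquality
  using (_≢_; refl; sym; trans; cong; cong₂; subst; isEquivalence)
open import Algebra.Bundles using (CommutativeMonoid)
open import Algebra.Properties.CommutativeSemigroup
  (CommutativeMonoid.commutativeSemigroup ℚ.+-0-commutativeMonoid) using (x∙yz≈y∙xz)

open ℚ.≤-Reasoning

NonNegativeWeights : ∀ {m} → (Fin m → ℚ) → Set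
NonNegativeWeights ℓ = ∀ i → 0ℚ ≤ ℓ i

x≤y+x : ∀ {y} → 0ℚ ≤ y → ∀ x → x ≤ y + x
x≤y+x {y} 0≤y x = begin
  x       ≡⟨ sym (ℚ.+-identityˡ x) ⟩
  0ℚ + x  ≤⟨ ℚ.+-monoˡ-≤ x 0≤y ⟩
  y + x   ∎

weightOf-∅ : ∀ {m} (ℓ : Fin m → ℚ) → weightOf ℓ ∅ ≡ 0ℚ
weightOf-∅ {zero}  ℓ = refl
weightOf-∅ {suc m} ℓ = weightOf-∅ (ℓ ∘ suc)

weightOf-Empty : ∀ {m} (ℓ : Fin m → ℚ) {p} → Empty p → weightOf ℓ p ≡ 0ℚ
weightOf-Empty ℓ ∅p rewrite Empty-unique ∅p = weightOf-∅ ℓ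

weightOf-⁅⁆ : ∀ {m} (ℓ : Fin m → ℚ) x → weightOf ℓ ⁅ x ⁆ ≡ ℓ x
weightOf-⁅⁆ ℓ zero    = trans (cong (ℓ zero +_) (weightOf-∅ (ℓ ∘ suc))) (ℚ.+-identityʳ (ℓ zero))
weightOf-⁅⁆ ℓ (suc x) = weightOf-⁅⁆ (ℓ ∘ suc) x

weightOf-monoˡ-≤ : ∀ {m} {f g : Fin m → ℚ} p → (∀ x → x ∈ p → f x ≤ g x) → weightOf f p ≤ weightOf g p
weightOf-monoˡ-≤ []            f≤g = ℚ.≤-refl
weightOf-monoˡ-≤ (outside ∷ p) f≤g = weightOf-monoˡ-≤ p (λ x x∈p → f≤g (suc x) (there x∈p))
weightOf-monoˡ-≤ (inside  ∷ p) f≤g =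
  ℚ.+-mono-≤ (f≤g zero here) (weightOf-monoˡ-≤ p (λ x x∈p → f≤g (suc x) (there x∈p)))

weightOf-monoʳ-⊆ : ∀ {m} {ℓ : Fin m → ℚ} → NonNegativeWeights ℓ → ∀ {p q} → p ⊆ q → weightOf ℓ p ≤ weightOf ℓ q
weightOf-monoʳ-⊆ ℓ≥0 {[]}          {[]}          p⊆q = ℚ.≤-refl
weightOf-monoʳ-⊆ ℓ≥0 {outside ∷ p} {outside ∷ q} p⊆q = weightOf-monoʳ-⊆ (ℓ≥0 ∘ suc) (drop-∷-⊆ p⊆q)
weightOf-monoʳ-⊆ ℓ≥0 {outside ∷ p} {inside  ∷ q} p⊆q =
  ℚ.≤-trans (weightOf-monoʳ-⊆ (ℓ≥0 ∘ suc) (drop-∷-⊆ p⊆q)) (x≤y+x (ℓ≥0 zero) _)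
weightOf-monoʳ-⊆ ℓ≥0 {inside  ∷ p} {outside ∷ q} p⊆q with p⊆q here
... | ()
weightOf-monoʳ-⊆ {ℓ = ℓ} ℓ≥0 {inside  ∷ p} {inside  ∷ q} p⊆q =
  ℚ.+-monoʳ-≤ (ℓ zero) (weightOf-monoʳ-⊆ (ℓ≥0 ∘ suc) (drop-∷-⊆ p⊆q))

weightOf-nonNeg : ∀ {m} {ℓ : Fin m → ℚ} → NonNegativeWeights ℓ → ∀ p → 0ℚ ≤ weightOf ℓ p
weightOf-nonNeg {ℓ = ℓ} ℓ≥0 p = subst (_≤ weightOf ℓ p) (weightOf-∅ ℓ) (weightOf-monoʳ-⊆ ℓ≥0 {q = p} ⊥⊆)

weightOf-∪ : ∀ {m} {ℓ : Fin m → ℚ} → NonNegativeWeights ℓ → ∀ p q →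
             weightOf ℓ (p ∪ q) ≤ weightOf ℓ p + weightOf ℓ q
weightOf-∪ ℓ≥0 []            []            = ℚ.≤-refl
weightOf-∪ ℓ≥0 (outside ∷ p) (outside ∷ q) = weightOf-∪ (ℓ≥0 ∘ suc) p q
weightOf-∪ {ℓ = ℓ} ℓ≥0 (outside ∷ p) (inside ∷ q) = begin
  ℓ zero + weightOf (ℓ ∘ suc) (p ∪ q)    ≤⟨ ℚ.+-monoʳ-≤ (ℓ zero) (weightOf-∪ (ℓ≥0 ∘ suc) p q) ⟩
  ℓ zero + (wp + wq)                     ≡⟨ x∙yz≈y∙xz (ℓ zero) wp wq ⟩
  wp + (ℓ zero + wq)                     ∎
  where wp = weightOf (ℓ ∘ suc) p; wq = weightOf (ℓ ∘ suc) q
weightOf-∪ {ℓ = ℓ} ℓ≥0 (inside ∷ p) (outside ∷ q) = begin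
  ℓ zero + weightOf (ℓ ∘ suc) (p ∪ q)    ≤⟨ ℚ.+-monoʳ-≤ (ℓ zero) (weightOf-∪ (ℓ≥0 ∘ suc) p q) ⟩
  ℓ zero + (wp + wq)                     ≡⟨ sym (ℚ.+-assoc (ℓ zero) wp wq) ⟩
  ℓ zero + wp + wq                       ∎
  where wp = weightOf (ℓ ∘ suc) p; wq = weightOf (ℓ ∘ suc) q
weightOf-∪ {ℓ = ℓ} ℓ≥0 (inside ∷ p) (inside ∷ q) = begin
  ℓ zero + weightOf (ℓ ∘ suc) (p ∪ q)    ≤⟨ ℚ.+-monoʳ-≤ (ℓ zero) (weightOf-∪ (ℓ≥0 ∘ suc) p q) ⟩
  ℓ zero + (wp + wq)                     ≡⟨ sym (ℚ.+-assoc (ℓ zero) wp wq) ⟩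
  ℓ zero + wp + wq                       ≤⟨ ℚ.+-monoʳ-≤ (ℓ zero + wp) (x≤y+x (ℓ≥0 zero) wq) ⟩
  ℓ zero + wp + (ℓ zero + wq)            ∎
  where wp = weightOf (ℓ ∘ suc) p; wq = weightOf (ℓ ∘ suc) q

p⊆p-x∪⁅x⁆ : ∀ {m} (p : Subset m) x → p ⊆ (p - x) ∪ ⁅ x ⁆
p⊆p-x∪⁅x⁆ p x {y} y∈p with y ≟ x
... | yes refl = x∈p∪q⁺ (inj₂ (x∈⁅x⁆ x))
... | no y≢x   = x∈p∪q⁺ (inj₁ (x∈p∧x≢y⇒x∈p-y y∈p y≢x))

weightOf[p]≤weightOf[p-x]+ℓx : ∀ {m} {ℓ : Fin m → ℚ} → NonNegativeWeights ℓ → ∀ p x → weightOf ℓ p ≤ weightOf ℓ (p - x) + ℓ x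
weightOf[p]≤weightOf[p-x]+ℓx {ℓ = ℓ} ℓ≥0 p x = begin
  weightOf ℓ p                             ≤⟨ weightOf-monoʳ-⊆ ℓ≥0 (p⊆p-x∪⁅x⁆ p x) ⟩
  weightOf ℓ ((p - x) ∪ ⁅ x ⁆)             ≤⟨ weightOf-∪ ℓ≥0 (p - x) ⁅ x ⁆ ⟩
  weightOf ℓ (p - x) + weightOf ℓ ⁅ x ⁆    ≡⟨ cong (weightOf ℓ (p - x) +_) (weightOf-⁅⁆ ℓ x) ⟩
  weightOf ℓ (p - x) + ℓ x                 ∎

weightOf-* : ∀ {m} c (f : Fin m → ℚ) p → weightOf (λ x → c * f x) p ≡ c * weightOf f p
weightOf-* c f []            = sym (ℚ.*-zeroʳ c)
weightOf-* c f (outside ∷ p) = weightOf-* c (f ∘ suc) p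
weightOf-* c f (inside  ∷ p) =
  trans (cong (c * f zero +_) (weightOf-* c (f ∘ suc) p)) (sym (ℚ.*-distribˡ-+ c (f zero) _))

⋃[_]_ : ∀ {m k} → Subset m → (Fin m → Subset k) → Subset k
⋃[ [] ]          F = ∅
⋃[ outside ∷ p ] F = ⋃[ p ] (F ∘ suc)
⋃[ inside  ∷ p ] F = F zero ∪ ⋃[ p ] (F ∘ suc)

∈-⋃ : ∀ {m k} {p : Subset m} {F : Fin m → Subset k} {x y} → x ∈ p → y ∈ F x → y ∈ ⋃[ p ] F
∈-⋃ here                        y∈Fx = x∈p∪q⁺ (inj₁ y∈Fx)
∈-⋃ {p = outside ∷ _} (there x∈p) y∈Fx = ∈-⋃ x∈p y∈Fx
∈-⋃ {p = inside  ∷ _} (there x∈p) y∈Fx = x∈p∪q⁺ (inj₂ (∈-⋃ x∈p y∈Fx))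

weightOf-⋃ : ∀ {m k} {ℓ : Fin k → ℚ} → NonNegativeWeights ℓ → ∀ p (F : Fin m → Subset k) →
             weightOf ℓ (⋃[ p ] F) ≤ weightOf (λ x → weightOf ℓ (F x)) p
weightOf-⋃ {ℓ = ℓ} ℓ≥0 []            F = ℚ.≤-reflexive (weightOf-∅ ℓ)
weightOf-⋃ ℓ≥0         (outside ∷ p) F = weightOf-⋃ ℓ≥0 p (F ∘ suc)
weightOf-⋃ {ℓ = ℓ} ℓ≥0 (inside  ∷ p) F = begin
  weightOf ℓ (F zero ∪ ⋃[ p ] (F ∘ suc))                   ≤⟨ weightOf-∪ ℓ≥0 (F zero) _ ⟩
  weightOf ℓ (F zero) + weightOf ℓ (⋃[ p ] (F ∘ suc))      ≤⟨ ℚ.+-monoʳ-≤ (weightOf ℓ (F zero)) (weightOf-⋃ ℓ≥0 p (F ∘ suc)) ⟩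
  weightOf ℓ (F zero) + weightOf (λ x → weightOf ℓ (F (suc x))) p ∎

module _ {c ℓ₁ ℓ₂} (O : TotalPreorder c ℓ₁ ℓ₂) where
  open TotalPreorder O using (Carrier; _≲_; total) renaming (refl to ≲-refl; trans to ≲-trans)

  Empty⊎argmax : ∀ {m} (f : Fin m → Carrier) (p : Subset m) →
                 Empty p ⊎ ∃ λ x → x ∈ p × (∀ y → y ∈ p → f y ≲ f x)
  Empty⊎argmax f [] = inj₁ λ ()
  Empty⊎argmax f (outside ∷ p) with Empty⊎argmax (f ∘ suc) p
  ... | inj₁ ∅p              = inj₁ λ { (suc x , there x∈p) → ∅p (x , x∈p) }
  ... | inj₂ (x , x∈p , max) = inj₂ (suc x , there x∈p , λ { (suc y) (there y∈p) → max y y∈p })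
  Empty⊎argmax f (inside ∷ p) with Empty⊎argmax (f ∘ suc) p
  ... | inj₁ ∅p = inj₂ (zero , here , λ { zero here → ≲-refl ; (suc y) (there y∈p) → ⊥-elim (∅p (y , y∈p)) })
  ... | inj₂ (x , x∈p , max) with total (f zero) (f (suc x))
  ...   | inj₁ f0≲fx = inj₂ (suc x , there x∈p , λ { zero here → f0≲fx ; (suc y) (there y∈p) → max y y∈p })
  ...   | inj₂ fx≲f0 = inj₂ (zero , here ,
                             λ { zero here → ≲-refl ; (suc y) (there y∈p) → ≲-trans (max y y∈p) fx≲f0 })

≤D-totalPreorder : TotalPreorder 0ℓ 0ℓ 0ℓ
≤D-totalPreorder = record
  { Carrier         = DL
  ; _≈_             = _≡_
  ; _≲_             = _≤D_
  ; isTotalPreorder = record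
    { isPreorder = record
      { isEquivalence = isEquivalence
      ; reflexive     = ≤D-reflexive
      ; trans         = λ {a} {b} {c} → ≤D-trans a b c
      }
    ; total = ≤D-total
    }
  }
  where
  ≤D-reflexive : ∀ {a b} → a ≡ b → a ≤D b
  ≤D-reflexive {just a}  refl = ℚ.≤-refl
  ≤D-reflexive {nothing} refl = tt
  ≤D-trans : ∀ a b c → a ≤D b → b ≤D c → a ≤D c
  ≤D-trans (just a) (just b)  (just c) a≤b b≤c = ℚ.≤-trans a≤b b≤c
  ≤D-trans (just a) nothing   (just c) _   ()
  ≤D-trans (just a) _         nothing  _   _   = tt
  ≤D-trans nothing  nothing   c        _   b≤c = b≤c
  ≤D-total : ∀ a b → a ≤D b ⊎ b ≤D a
  ≤D-total (just a) (just b) = ℚ.≤-total a b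
  ≤D-total (just a) nothing  = inj₁ tt
  ≤D-total nothing  (just b) = inj₂ tt
  ≤D-total nothing  nothing  = inj₁ tt

module _ {n} {d : Node n → DL} {ℓ : Node n → ℚ} {A : Subset (suc n)} {β : ℚ} {S : Subset (suc n)} where

  IsU-drop-max : IsU d ℓ A β S → ∀ {u} → u ∈ S → (∀ w → w ∈ S → d w ≤D d u) → weightOf ℓ (S - u) < β
  IsU-drop-max ((S⊆A , prefix , _) , minimal) {u} u∈S max =
    ℚ.≰⇒> λ β≤ → ℕₚ.<⇒≱ (x∈p⇒∣p-x∣<∣p∣ u∈S) (minimal (S - u) (S⊆A ∘ S-u⊆S , prefix′ , inj₁ β≤))
    where
    S-u⊆S : S - u ⊆ S
    S-u⊆S = p─q⊆p S ⁅ u ⁆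
    prefix′ : ∀ x w → x ∈ S - u → w ∈ A → w ∉ S - u → d x ≤D d w
    prefix′ x w x∈S-u w∈A w∉S-u with w ≟ u
    ... | yes refl = max x (S-u⊆S x∈S-u)
    ... | no w≢u   = prefix x w (S-u⊆S x∈S-u) w∈A (λ w∈S → w∉S-u (x∈p∧x≢y⇒x∈p-y w∈S w≢u))

  weightOf-IsU≤ : NonNegativeWeights ℓ → ∀ {γ} → 0ℚ ≤ β + γ → (∀ u → u ∈ A → ℓ u ≤ γ) →
                  IsU d ℓ A β S → weightOf ℓ S ≤ β + γ
  weightOf-IsU≤ ℓ≥0 {γ} 0≤β+γ ℓ≤γ isU with Empty⊎argmax ≤D-totalPreorder d S
  ... | inj₁ ∅S = ℚ.≤-trans (ℚ.≤-reflexive (weightOf-Empty ℓ ∅S)) 0≤β+γ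
  ... | inj₂ (u , u∈S , max) = begin
    weightOf ℓ S             ≤⟨ weightOf[p]≤weightOf[p-x]+ℓx ℓ≥0 S u ⟩
    weightOf ℓ (S - u) + ℓ u ≤⟨ ℚ.+-mono-≤ (ℚ.<⇒≤ (IsU-drop-max isU u∈S max)) (ℓ≤γ u (proj₁ (proj₁ isU) u∈S)) ⟩
    β + γ                    ∎

  IsU-nonPos⇒Empty : NonNegativeWeights ℓ → β ≤ 0ℚ → IsU d ℓ A β S → Empty S
  IsU-nonPos⇒Empty ℓ≥0 β≤0 isU with Empty⊎argmax ≤D-totalPreorder d S
  ... | inj₁ ∅S = ∅S
  ... | inj₂ (u , u∈S , max) = contradiction
    (ℚ.≤-<-trans (weightOf-nonNeg ℓ≥0 (S - u)) (ℚ.<-≤-trans (IsU-drop-max isU u∈S max) β≤0))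
    (ℚ.<-irrefl refl)

x+y*x≡[1+y]*x : ∀ x y → x + y * x ≡ (1ℚ + y) * x
x+y*x≡[1+y]*x = solve 2 (λ x y → x :+ y :* x := (con 1ℚ :+ y) :* x) refl

x+[1+y]*x≡[1+1+y]*x : ∀ x y → x + (1ℚ + y) * x ≡ (1ℚ + 1ℚ + y) * x
x+[1+y]*x≡[1+1+y]*x = solve 2 (λ x y → x :+ (con 1ℚ :+ y) :* x := (con 1ℚ :+ con 1ℚ :+ y) :* x) refl

L*x≤y⇒x≤1/L*y : ∀ {L x y} .{{_ : NonZero L}} → 0ℚ < L → L * x ≤ y → x ≤ 1/ L * y
L*x≤y⇒x≤1/L*y {L} {x} {y} 0<L L*x≤y = ℚ.*-cancelˡ-≤-pos L {{positive 0<L}} (begin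
  L * x             ≤⟨ L*x≤y ⟩
  y                 ≡⟨ sym (ℚ.*-identityˡ y) ⟩
  1ℚ * y            ≡⟨ cong (_* y) (sym (ℚ.*-inverseʳ L)) ⟩
  L * 1/ L * y      ≡⟨ ℚ.*-assoc L (1/ L) y ⟩
  L * (1/ L * y)    ∎)

depth>0⇒≢root : ∀ {n} (T : RootedTree n) {u} → 0 ℕ.< depth T u → u ≢ root
depth>0⇒≢root T 0<du refl = ℕₚ.<⇒≢ 0<du (sym (depth-root T))

isDesc⇒ancestor : ∀ {n} (T : RootedTree n) {w v} → True (isDesc T w v) →
                  ∃ λ k → k ℕ.≤ depth T w × ancestor T k w ≡ v
isDesc⇒ancestor T desc with find (any⁻ _ _ desc)
... | k , k∈ , wk≡v = k , ℕ.s≤s⁻¹ (∈-upTo⁻ k∈) , toWitness wk≡v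

∈-Zset⁻ : ∀ {n} (T : RootedTree n) {X i v w} → w ∈ Zset T X i v → depth T w ≡ i × True (isDesc T w v)
∈-Zset⁻ T {X} {i} {v} {w} w∈Z =
  ℕₚ.≡ᵇ⇒≡ _ _ (proj₁ split) , proj₂ (Equivalence.to (T-∧ {⌊ parent T w ∈? X ⌋}) (proj₂ split))
  where
  condition : Node _ → Bool
  condition u = (depth T u ℕ.≡ᵇ i) ∧ (⌊ parent T u ∈? X ⌋ ∧ isDesc T u v)
  split : True (depth T w ℕ.≡ᵇ i) × True (⌊ parent T w ∈? X ⌋ ∧ isDesc T w v)
  split = Equivalence.to T-∧ (Equivalence.from T-≡ (trans (sym (lookup∘tabulate condition w)) ([]=⇒lookup w∈Z)))

module _ {n} (T : RootedTree n) {ℓ : Node n → ℚ} (valid : ValidWeights ℓ)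
         {L : ℚ} .{{_ : NonZero L}} (1≤L : 1ℚ ≤ L) (decreasing : LDecreasing T ℓ L) where

  private
    ℓ≥0 : NonNegativeWeights ℓ
    ℓ≥0 v with v ≟ root
    ... | yes refl = ℚ.≤-reflexive (sym (proj₁ valid))
    ... | no v≢r   = ℚ.<⇒≤ (proj₂ valid v v≢r)

    0<L : 0ℚ < L
    0<L = ℚ.<-≤-trans (ℚ.positive⁻¹ 1ℚ) 1≤L

    1+1/L : ℚ
    1+1/L = 1ℚ + 1/ L

    1/L>0 : Positive (1/ L)
    1/L>0 = ℚ.1/pos⇒pos L {{positive 0<L}}

    0≤1+1/L : 0ℚ ≤ 1+1/L
    0≤1+1/L = ℚ.+-mono-≤ (ℚ.<⇒≤ (ℚ.positive⁻¹ 1ℚ)) (ℚ.<⇒≤ (ℚ.positive⁻¹ (1/ L) {{1/L>0}}))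

    2+1/L : ℚ
    2+1/L = 1ℚ + 1ℚ + 1/ L

    0≤2+1/L : 0ℚ ≤ 2+1/L
    0≤2+1/L = ℚ.+-mono-≤ (ℚ.<⇒≤ (ℚ.positive⁻¹ (1ℚ + 1ℚ))) (ℚ.<⇒≤ (ℚ.positive⁻¹ (1/ L) {{1/L>0}}))

    0≤1+1/L* : ∀ {x} → 0ℚ ≤ x → 0ℚ ≤ 1+1/L * x
    0≤1+1/L* 0≤x = ℚ.≤-trans (ℚ.≤-reflexive (sym (ℚ.*-zeroʳ 1+1/L)))
                             (ℚ.*-monoˡ-≤-nonNeg 1+1/L {{nonNegative 0≤1+1/L}} 0≤x)

  -- The depth bound keeps the chain below the root, whose parent is unconstrained.
  L*ℓ≤ℓ-ancestor : ∀ k u → suc k ℕ.≤ depth T u → ancestor T (suc k) u ≢ root →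
                   L * ℓ u ≤ ℓ (ancestor T (suc k) u)
  L*ℓ≤ℓ-ancestor zero    u 1≤du pu≢r = decreasing u (depth>0⇒≢root T 1≤du) pu≢r
  L*ℓ≤ℓ-ancestor (suc k) u 2+k≤du a≢r = begin
    L * ℓ u                         ≤⟨ decreasing u u≢r pu≢r ⟩
    ℓ pu                            ≡⟨ sym (ℚ.*-identityˡ (ℓ pu)) ⟩
    1ℚ * ℓ pu                       ≤⟨ ℚ.*-monoʳ-≤-nonNeg (ℓ pu) {{nonNegative (ℓ≥0 pu)}} 1≤L ⟩
    L * ℓ pu                        ≤⟨ L*ℓ≤ℓ-ancestor k pu 1+k≤dpu a≢r ⟩
    ℓ (ancestor T (suc k) pu)       ∎
    where
    pu = parent T u
    u≢r : u ≢ root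
    u≢r = depth>0⇒≢root T (ℕₚ.<-≤-trans ℕ.z<s 2+k≤du)
    1+k≤dpu : suc k ℕ.≤ depth T pu
    1+k≤dpu = ℕ.s≤s⁻¹ (subst (suc (suc k) ℕ.≤_) (depth-parent T u u≢r) 2+k≤du)
    pu≢r : pu ≢ root
    pu≢r = depth>0⇒≢root T (ℕₚ.<-≤-trans ℕ.z<s 1+k≤dpu)

  ℓ-Zset≤ : ∀ {X i v u} → v ≢ root → depth T v ℕ.< i → u ∈ Zset T X i v → ℓ u ≤ 1/ L * ℓ v
  ℓ-Zset≤ v≢r dv<i u∈Z with ∈-Zset⁻ T u∈Z
  ... | du≡i , desc with isDesc⇒ancestor T desc
  ...   | zero  , _      , refl = contradiction du≡i (ℕₚ.<⇒≢ dv<i)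
  ...   | suc k , 1+k≤du , refl = L*x≤y⇒x≤1/L*y 0<L (L*ℓ≤ℓ-ancestor k _ 1+k≤du v≢r)

  weightOf-U≤ : ∀ {d X i v S} → depth T v ℕ.< i → IsU d ℓ (Zset T X i v) (ℓ v) S →
                weightOf ℓ S ≤ 1+1/L * ℓ v
  weightOf-U≤ {v = v} {S} dv<i isU with v ≟ root
  ... | yes refl = subst (_≤ 1+1/L * ℓ root)
    (sym (weightOf-Empty ℓ (IsU-nonPos⇒Empty ℓ≥0 (ℚ.≤-reflexive (proj₁ valid)) isU)))
    (0≤1+1/L* (ℓ≥0 root))
  ... | no v≢r = begin
    weightOf ℓ S           ≤⟨ weightOf-IsU≤ ℓ≥0 0≤ℓv+ℓv/L (λ u u∈Z → ℓ-Zset≤ v≢r dv<i u∈Z) isU ⟩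
    ℓ v + 1/ L * ℓ v       ≡⟨ x+y*x≡[1+y]*x (ℓ v) (1/ L) ⟩
    1+1/L * ℓ v            ∎
    where
    0≤ℓv+ℓv/L : 0ℚ ≤ ℓ v + 1/ L * ℓ v
    0≤ℓv+ℓv/L = subst (0ℚ ≤_) (sym (x+y*x≡[1+y]*x (ℓ v) (1/ L))) (0≤1+1/L* (ℓ≥0 v))

  weightOf-Step≤ : ∀ {d i X X′} → Step T ℓ d i X X′ → weightOf ℓ X′ ≤ 2+1/L * weightOf ℓ X
  weightOf-Step≤ {i = i} {X} {X′} (S , isU , X′⊆ , _ , _) = begin
    weightOf ℓ X′                                          ≤⟨ weightOf-monoʳ-⊆ ℓ≥0 X′⊆X∪⋃F ⟩
    weightOf ℓ (X ∪ ⋃[ X ] F)                              ≤⟨ weightOf-∪ ℓ≥0 X (⋃[ X ] F) ⟩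
    weightOf ℓ X + weightOf ℓ (⋃[ X ] F)                   ≤⟨ ℚ.+-monoʳ-≤ (weightOf ℓ X) (weightOf-⋃ ℓ≥0 X F) ⟩
    weightOf ℓ X + weightOf (λ v → weightOf ℓ (F v)) X     ≤⟨ ℚ.+-monoʳ-≤ (weightOf ℓ X) (weightOf-monoˡ-≤ X weightOfF≤) ⟩
    weightOf ℓ X + weightOf (λ v → 1+1/L * ℓ v) X          ≡⟨ cong (weightOf ℓ X +_) (weightOf-* 1+1/L ℓ X) ⟩
    weightOf ℓ X + 1+1/L * weightOf ℓ X                    ≡⟨ x+[1+y]*x≡[1+1+y]*x (weightOf ℓ X) (1/ L) ⟩
    2+1/L * weightOf ℓ X                                   ∎
    where
    -- Step constrains S v only for depth v < i; elsewhere S v is arbitrary.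
    F : Node n → Subset (suc n)
    F v with depth T v ℕ.<? i
    ... | yes _ = S v
    ... | no  _ = ∅
    ∈F : ∀ {v w} → depth T v ℕ.< i → w ∈ S v → w ∈ F v
    ∈F {v} dv<i w∈Sv with depth T v ℕ.<? i
    ... | yes _     = w∈Sv
    ... | no  dv≮i = contradiction dv<i dv≮i
    X′⊆X∪⋃F : X′ ⊆ X ∪ ⋃[ X ] F
    X′⊆X∪⋃F w∈X′ with X′⊆ _ w∈X′
    ... | inj₁ w∈X                    = x∈p∪q⁺ (inj₁ w∈X)
    ... | inj₂ (v , v∈X , dv<i , w∈Sv) = x∈p∪q⁺ (inj₂ (∈-⋃ v∈X (∈F dv<i w∈Sv)))
    weightOfF≤ : ∀ v → v ∈ X → weightOf ℓ (F v) ≤ 1+1/L * ℓ v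
    weightOfF≤ v v∈X with depth T v ℕ.<? i
    ... | yes dv<i = weightOf-U≤ dv<i (isU v v∈X dv<i)
    ... | no  _    = subst (_≤ 1+1/L * ℓ v) (sym (weightOf-∅ ℓ)) (0≤1+1/L* (ℓ≥0 v))

  Reach⇒2≤ : ∀ {d q k X} → Reach T ℓ d q k X → 2 ℕ.≤ k
  Reach⇒2≤ (init _ _ _ _) = ℕₚ.≤-refl
  Reach⇒2≤ (step r _)     = ℕₚ.m≤n⇒m≤1+n (Reach⇒2≤ r)

  weightOf-Reach≤ : ∀ {d q k X} → Reach T ℓ d q k X → weightOf ℓ X ≤ 2+1/L ^Q (k ∸ 2) * ℓ q
  weightOf-Reach≤ {q = q} (init X X⊆rq _ _) = begin
    weightOf ℓ X                   ≤⟨ weightOf-monoʳ-⊆ ℓ≥0 X⊆⁅r⁆∪⁅q⁆ ⟩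
    weightOf ℓ (⁅ root ⁆ ∪ ⁅ q ⁆)  ≤⟨ weightOf-∪ ℓ≥0 ⁅ root ⁆ ⁅ q ⁆ ⟩
    weightOf ℓ ⁅ root ⁆ + weightOf ℓ ⁅ q ⁆ ≡⟨ cong₂ _+_ (trans (weightOf-⁅⁆ ℓ root) (proj₁ valid)) (weightOf-⁅⁆ ℓ q) ⟩
    0ℚ + ℓ q                       ≡⟨ ℚ.+-identityˡ (ℓ q) ⟩
    ℓ q                            ≡⟨ sym (ℚ.*-identityˡ (ℓ q)) ⟩
    1ℚ * ℓ q                       ∎
    where
    X⊆⁅r⁆∪⁅q⁆ : X ⊆ ⁅ root ⁆ ∪ ⁅ q ⁆
    X⊆⁅r⁆∪⁅q⁆ w∈X with X⊆rq _ w∈X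
    ... | inj₁ refl = x∈p∪q⁺ (inj₁ (x∈⁅x⁆ root))
    ... | inj₂ refl = x∈p∪q⁺ (inj₂ (x∈⁅x⁆ q))
  weightOf-Reach≤ {q = q} (step {i} {X} {X′} r st) = begin
    weightOf ℓ X′                        ≤⟨ weightOf-Step≤ st ⟩
    2+1/L * weightOf ℓ X                 ≤⟨ ℚ.*-monoˡ-≤-nonNeg 2+1/L {{nonNegative 0≤2+1/L}} (weightOf-Reach≤ r) ⟩
    2+1/L * (2+1/L ^Q (i ∸ 2) * ℓ q)     ≡⟨ sym (ℚ.*-assoc 2+1/L (2+1/L ^Q (i ∸ 2)) (ℓ q)) ⟩
    2+1/L ^Q suc (i ∸ 2) * ℓ q           ≡⟨ cong (λ e → 2+1/L ^Q e * ℓ q) (sym (ℕₚ.+-∸-assoc 1 (Reach⇒2≤ r))) ⟩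
    2+1/L ^Q (suc i ∸ 2) * ℓ q           ∎

mainTheorem4 : (n : ℕ) (T : RootedTree n) (ℓ : Node n → ℚ) → ValidWeights ℓ →
    (L : ℚ) .{{_ : NonZero L}} → 1ℚ ≤ L → LDecreasing T ℓ L →
    (D : ℕ) → HasDepth T D →
    (q : Node n) → SingleRootChild T q →
    (P : List (Request n)) → Unique (map proj₂ P) →
    (t : ℚ) → dt T P root ≡ just t →
    (X : Subset (suc n)) → ServedSet T ℓ (dt T P) q D X →
    weightOf ℓ X ≤ ((1ℚ + 1ℚ + 1/ L) ^Q (D ∸ 1)) * ℓ q
mainTheorem4 _ T _ valid _ 1≤L decreasing _ _ _ _ _ _ _ _ _ served =
  weightOf-Reach≤ T valid 1≤L decreasing served
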